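{- Let $(G,T,p)$ be an instance of Directed Vertex Multiway Cut and let $S$ be an inclusion-wise minimal solution. Then no $v\in S$ is in the reverse shadow (with respect to $T$) of some $S'\subseteq S\setminus\{v\}$.
   Context: An instance consists of a directed graph $G$, terminals $T$, distinguished vertices $V^{\infty}(G)\supseteq T$ and an integer $p$; a solution is $S\subseteq V(G)\setminus V^{\infty}(G)$ with $|S|\le p$ such that $G\setminus S$ has no directed path between distinct terminals. For disjoint nonempty $X,Y$, a set $S\subseteq V(G)\setminus(X\cup Y\cup V^{\infty}(G))$ is an $X-Y$ separator if $G\setminus S$ has no directed path from $X$ to $Y$. The reverse shadow $r(S')$ is the set of vertices $v$ such that $S'$ is a $\{v\}-T$ separator. -}

module Defs where

open import Data.Nat using (ℕ; _≤_)
open import Data.Fin using (Fin)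
open import Data.Fin.Subset using (Subset; _∈_; _∉_; _⊆_; ⁅_⁆; ∣_∣)
open import Data.Product using (_×_)
open import Relation.Binary.PropositionalEquality using (_≡_)
open import Relation.Nullary using (¬_)
open import Level using (0ℓ; suc)

Digraph : ℕ → Set₁
Digraph n = Fin n → Fin n → Set

-- A directed path from x to y in G ∖ S (every vertex of the path,
-- including both endpoints, lies outside S).
data PathAvoiding {n : ℕ} (G : Digraph n) (S : Subset n) : Fin n → Fin n → Set where
  here : ∀ {x} → x ∉ S → PathAvoiding G S x x
  step : ∀ {x y z} → x ∉ S → G x y → PathAvoiding G S y z → PathAvoiding G S x z

record Instance (n : ℕ) : Set₁ where
  field
    G     : Digraph n
    T     : Subset n
    Vinf  : Subset n          -- undeletable vertices V^∞(G)
    T⊆Vinf : T ⊆ Vinf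
    p     : ℕ

module _ {n : ℕ} (I : Instance n) where
  open Instance I

  IsSolution : Subset n → Set
  IsSolution S =
    (∀ {x} → x ∈ S → x ∉ Vinf) ×
    (∣ S ∣ ≤ p) ×
    (∀ {t t'} → t ∈ T → t' ∈ T → ¬ (t ≡ t') → ¬ PathAvoiding G S t t')

  IsMinimalSolution : Subset n → Set
  IsMinimalSolution S =
    IsSolution S × (∀ S'' → S'' ⊆ S → IsSolution S'' → S ⊆ S'')

  IsSeparator : Subset n → Subset n → Subset n → Set
  IsSeparator X Y S =
    (∀ {x} → x ∈ S → (x ∉ X) × (x ∉ Y) × (x ∉ Vinf)) ×
    (∀ {x y} → x ∈ X → y ∈ Y → ¬ PathAvoiding G S x y)

  -- v is in the reverse shadow r(S') (w.r.t. T): S' is a {v}–T separator.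
  -- (The separator notion is only defined for disjoint X, Y, so v ∉ T.)
  InReverseShadow : Subset n → Fin n → Set
  InReverseShadow S' v = (v ∉ T) × IsSeparator ⁅ v ⁆ T S'

module Submission where

-- Let S be a minimal solution, v ∈ S, and S' ⊆ S ∖ {v}
-- a {v}–T separator.  We show that S ∖ {v} is still a solution, which
-- contradicts minimality since S ∖ {v} is a proper subset of S.
-- Only the path condition needs work: take a terminal-to-terminal path
-- avoiding S ∖ {v}.  If it visited v, its tail would be a path from v to a
-- terminal avoiding S ∖ {v} ⊇ S', which the separator S' forbids.  Hence
-- the path avoids v as well, i.e. it avoids all of S — impossible.

open import Defs
open import Data.Nat using (ℕ)
open import Data.Nat.Properties using (≤-trans)
open import Data.Fin using (Fin)
open import Data.Fin.Properties using (_≟_)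
open import Data.Fin.Subset using (Subset; _∈_; _∉_; _⊆_; _─_; ⁅_⁆)
open import Data.Fin.Subset.Properties
  using (x∈p∧x∉q⇒x∈p─q; p─q⊆p; ∣p─q∣≤∣p∣; x∈⁅x⁆; x∈⁅y⁆⇒x≡y; x∈p∩q⁺; p∩q≢∅⇒p─q⊂p)
open import Data.Product using (_,_; proj₁)
open import Data.Empty using (⊥-elim)
open import Relation.Binary.PropositionalEquality using (_≢_; refl; subst)
open import Relation.Nullary using (¬_; yes; no)

avoiding-antitone : ∀ {n} {G : Digraph n} {A B : Subset n} → B ⊆ A →
                    ∀ {x y} → PathAvoiding G A x y → PathAvoiding G B x y
avoiding-antitone B⊆A (here x∉A)     = here (λ x∈B → x∉A (B⊆A x∈B))
avoiding-antitone B⊆A (step x∉A e P) = step (λ x∈B → x∉A (B⊆A x∈B)) e (avoiding-antitone B⊆A P)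

∉-deletion : ∀ {n} {A : Subset n} {v x : Fin n} → x ∉ A ─ ⁅ v ⁆ → x ≢ v → x ∉ A
∉-deletion x∉A─v x≢v x∈A = x∉A─v (x∈p∧x∉q⇒x∈p─q x∈A (λ x∈⁅v⁆ → x≢v (x∈⁅y⁆⇒x≡y _ x∈⁅v⁆)))

⊆-deletion : ∀ {n} {A B : Subset n} {v : Fin n} → B ⊆ A → v ∉ B → B ⊆ A ─ ⁅ v ⁆
⊆-deletion B⊆A v∉B {x} x∈B =
  x∈p∧x∉q⇒x∈p─q (B⊆A x∈B) (λ x∈⁅v⁆ → v∉B (subst (_∈ _) (x∈⁅y⁆⇒x≡y _ x∈⁅v⁆) x∈B))

avoiding-deletion : ∀ {n} {G : Digraph n} {A Y : Subset n} {v : Fin n} →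
                    (∀ {y} → y ∈ Y → ¬ PathAvoiding G (A ─ ⁅ v ⁆) v y) →
                    ∀ {x y} → y ∈ Y → PathAvoiding G (A ─ ⁅ v ⁆) x y → PathAvoiding G A x y
avoiding-deletion {v = v} v↛Y {x} y∈Y P with x ≟ v
... | yes refl = ⊥-elim (v↛Y y∈Y P)
... | no x≢v with P
...   | here x∉       = here (∉-deletion x∉ x≢v)
...   | step x∉ e P'  = step (∉-deletion x∉ x≢v) e (avoiding-deletion v↛Y y∈Y P')

module _ {n : ℕ} (I : Instance n) where
  open Instance I

  deletion-is-solution : ∀ {S : Subset n} {v : Fin n} → IsSolution I S →
                         (∀ {t} → t ∈ T → ¬ PathAvoiding G (S ─ ⁅ v ⁆) v t) →
                         IsSolution I (S ─ ⁅ v ⁆)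
  deletion-is-solution {S} {v} (undeletable , small , separating) v↛T =
      (λ x∈ → undeletable (p─q⊆p S ⁅ v ⁆ x∈))
    , ≤-trans (∣p─q∣≤∣p∣ S ⁅ v ⁆) small
    , λ t∈T t'∈T t≢t' P → separating t∈T t'∈T t≢t' (avoiding-deletion v↛T t'∈T P)

  minimal-no-deletion : ∀ {S : Subset n} {v : Fin n} → IsMinimalSolution I S →
                        v ∈ S → ¬ IsSolution I (S ─ ⁅ v ⁆)
  minimal-no-deletion {S} {v} (_ , minimal) v∈S solution
    with p∩q≢∅⇒p─q⊂p S ⁅ v ⁆ (v , x∈p∩q⁺ (v∈S , x∈⁅x⁆ v))
  ... | _ , _ , x∈S , x∉S─v = x∉S─v (minimal (S ─ ⁅ v ⁆) (p─q⊆p S ⁅ v ⁆) solution x∈S)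

lemma11 : {n : ℕ} (I : Instance n) (S : Subset n) → IsMinimalSolution I S →
          ∀ v → v ∈ S → (S' : Subset n) → S' ⊆ S → v ∉ S' →
          ¬ InReverseShadow I S' v
lemma11 I S minimalS v v∈S S' S'⊆S v∉S' (_ , _ , S'-separates) =
  minimal-no-deletion I minimalS v∈S
    (deletion-is-solution I (proj₁ minimalS) v↛T)
  where
  -- S' ⊆ S ∖ {v}, so a path from v to a terminal avoiding S ∖ {v} would
  -- avoid the separator S'.
  v↛T : ∀ {t} → t ∈ Instance.T I → ¬ PathAvoiding (Instance.G I) (S ─ ⁅ v ⁆) v t
  v↛T t∈T P = S'-separates (x∈⁅x⁆ v) t∈T (avoiding-antitone (⊆-deletion S'⊆S v∉S') P)
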